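{- Let $A$ be an arena, $\sigma : A$ a causal strategy, and $m, n^- \in |\sigma|$ compatible (lying in a common configuration), with $n$ negative. Then $m <_\sigma n$ immediately if and only if $\partial_\sigma(m) <_A \partial_\sigma(n)$ immediately (where "immediately" means with no event strictly in between).
   Context: An arena is an event structure with polarities and symmetry which is alternating, forestial (the events below a given event are totally ordered) and race-free. A causal strategy $\sigma : A$ has a display map $\partial_\sigma$ which is a map of event structures (sends configurations of $\sigma$ to configurations of $A$ and is locally injective on configurations), polarities imported from $A$, and is courteous: if $s_1<_\sigma s_2$ immediately and $\mathrm{pol}(s_1)=+$ or $\mathrm{pol}(s_2)=-$, then $\partial_\sigma(s_1)<_A\partial_\sigma(s_2)$ immediately; it is also receptive. -}

module Defs where

open import Data.List using (List; []; _∷_; map)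
open import Data.List.Membership.Propositional using (_∈_; _∉_)
open import Data.List.Relation.Binary.Subset.Propositional using (_⊆_)
open import Data.Product using (Σ; _×_; _,_; ∃; ∃-syntax)
open import Data.Sum using (_⊎_)
open import Data.Empty using (⊥)
open import Relation.Binary.PropositionalEquality using (_≡_; _≢_)

data Pol : Set where
  plus minus : Pol

record EventStructure : Set₁ where
  field
    E         : Set
    _≤_       : E → E → Set
    ≤-refl    : ∀ {e} → e ≤ e
    ≤-trans   : ∀ {e₁ e₂ e₃} → e₁ ≤ e₂ → e₂ ≤ e₃ → e₁ ≤ e₃
    ≤-antisym : ∀ {e₁ e₂} → e₁ ≤ e₂ → e₂ ≤ e₁ → e₁ ≡ e₂
    -- finite causes: [e] = {e' | e' ≤ e} is finite
    history   : E → List E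
    history-≤ : ∀ {e e'} → e' ≤ e → e' ∈ history e
    ≤-history : ∀ {e e'} → e' ∈ history e → e' ≤ e
    Con        : List E → Set
    Con-single : ∀ e → Con (e ∷ [])
    Con-sub    : ∀ {X Y} → X ⊆ Y → Con Y → Con X
    Con-down   : ∀ {X e e'} → Con X → e ∈ X → e' ≤ e → Con (e' ∷ X)

  _<_ : E → E → Set
  e < e' = (e ≤ e') × (e ≢ e')

  _⋖_ : E → E → Set
  e ⋖ e' = (e < e') × (∀ p → e < p → p < e' → ⊥)

  IsConfig : List E → Set
  IsConfig x = Con x × (∀ {e e'} → e ∈ x → e' ≤ e → e' ∈ x)

  Compatible : E → E → Set
  Compatible e e' = ∃[ x ] (IsConfig x × e ∈ x × e' ∈ x)

  Extends : List E → E → Set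
  Extends x e = IsConfig x × e ∉ x × IsConfig (e ∷ x)

open EventStructure public using (E; _≤_; IsConfig; Extends; Compatible)
  renaming (_⋖_ to Immediate)

-- Arenas (symmetry omitted)

record Arena : Set₁ where
  field
    es  : EventStructure
    pol : E es → Pol
    alternating : ∀ {a a'} → Immediate es a a' → pol a ≢ pol a'
    forestial   : ∀ {a b c} → _≤_ es b a → _≤_ es c a →
                  (_≤_ es b c) ⊎ (_≤_ es c b)
    race-free   : ∀ {x a₁ a₂} → Extends es x a₁ → Extends es x a₂ →
                  pol a₁ ≢ pol a₂ → IsConfig es (a₁ ∷ a₂ ∷ x)

open Arena public

record IsMap (S T : EventStructure) (f : E S → E T) : Set where
  field
    config-preserving : ∀ {x} → IsConfig S x → IsConfig T (map f x)
    locally-injective : ∀ {x e e'} → IsConfig S x → e ∈ x → e' ∈ x →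
                        f e ≡ f e' → e ≡ e'

record CausalStrategy (A : Arena) : Set₁ where
  field
    σ   : EventStructure
    ∂   : E σ → E (es A)
    ∂-map : IsMap σ (es A) ∂

  polσ : E σ → Pol
  polσ s = pol A (∂ s)

  field
    courteous : ∀ {s₁ s₂} → Immediate σ s₁ s₂ →
                (polσ s₁ ≡ plus) ⊎ (polσ s₂ ≡ minus) →
                Immediate (es A) (∂ s₁) (∂ s₂)
    receptive : ∀ {x a} → IsConfig σ x → Extends (es A) (map ∂ x) a →
                pol A a ≡ minus →
                Σ (E σ) λ s → (Extends σ x s × ∂ s ≡ a) ×
                  (∀ s' → Extends σ x s' → ∂ s' ≡ a → s' ≡ s)

open CausalStrategy public

{-# OPTIONS --safe #-}
module Submission where

-- Courtesy gives the forward direction, since n is negative. Conversely, let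
-- ∂m ⋖ ∂n. The history [n] is a configuration containing n, so its image
-- contains ∂m, and local injectivity on a configuration containing both
-- events yields m ≤ n. If some p had m < p < n, then n would have an
-- immediate predecessor s ≥ p; courtesy makes ∂s ⋖ ∂n, and in a forest an
-- event has at most one immediate predecessor, so ∂s = ∂m, whence s = m,
-- contradicting m < p ≤ s. As < is not decidable, s is only obtained under a
-- double negation, which is harmless because the goal is ⊥.

open import Defs using (EventStructure)
open import Relation.Binary.PropositionalEquality using (_≡_; _≢_; refl; sym; cong; subst)
open import Function.Bundles using (_⇔_; mk⇔)
open import Data.List using (List; []; _∷_)
open import Data.List.Membership.Propositional using (_∈_)
open import Data.List.Membership.Propositional.Properties using (∈-map⁺; ∈-map⁻)
open import Data.List.Relation.Unary.Any using (here; there)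
open import Data.Product using (_×_; _,_; proj₁; proj₂; ∃-syntax)
open import Data.Sum using (inj₁; inj₂)
open import Data.Empty using (⊥)
open import Effect.Monad using (RawMonad)
open import Level using (0ℓ)
open import Function.Base using (case_of_)
open import Relation.Nullary using (¬_; yes; no)
open import Relation.Nullary.Decidable using (¬¬-excluded-middle)
open import Relation.Nullary.Negation using (DoubleNegation; ¬¬-Monad)

open RawMonad (¬¬-Monad {0ℓ}) using (pure; _>>=_)

module _ (X : EventStructure) where
  open EventStructure X

  <⇒≱ : ∀ {a b} → a < b → ¬ (b ≤ a)
  <⇒≱ (a≤b , a≢b) b≤a = a≢b (≤-antisym a≤b b≤a)

  history-isConfig : ∀ {x e} → IsConfig x → e ∈ x → IsConfig (history e)
  history-isConfig (con , down) e∈x =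
    Con-sub (λ e'∈[e] → down e∈x (≤-history e'∈[e])) con ,
    λ e'∈[e] e''≤e' → history-≤ (≤-trans e''≤e' (≤-history e'∈[e]))

  ¬¬-topmost-between : ∀ {p n} (L : List E) → p < n →
    DoubleNegation (∃[ s ] p ≤ s × s < n × (∀ {q} → q ∈ L → s < q → q < n → ⊥))
  ¬¬-topmost-between [] p<n = pure (_ , ≤-refl , p<n , λ ())
  ¬¬-topmost-between (q ∷ L) p<n = do
    (s , p≤s , s<n , s-top) ← ¬¬-topmost-between L p<n
    q-between? ← ¬¬-excluded-middle
    case q-between? of λ where
      (no q-not-between) → pure (s , p≤s , s<n , λ where
        (here refl) s<q q<n → q-not-between (s<q , q<n)
        (there q'∈L) → s-top q'∈L)
      (yes (s<q , q<n)) → do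
        (s' , q≤s' , s'<n , s'-top) ← ¬¬-topmost-between L q<n
        pure (s' , ≤-trans p≤s (≤-trans (proj₁ s<q) q≤s') , s'<n , λ where
          (here refl) s'<q _ → <⇒≱ s'<q q≤s'
          (there q'∈L) → s'-top q'∈L)

  ¬¬-immediate-above : ∀ {p n} → p < n → DoubleNegation (∃[ s ] p ≤ s × s ⋖ n)
  ¬¬-immediate-above {n = n} p<n = do
    (s , p≤s , s<n , s-top) ← ¬¬-topmost-between (history n) p<n
    pure (s , p≤s , s<n , λ q s<q q<n → s-top (history-≤ (proj₁ q<n)) s<q q<n)

open Defs

module _ {S T : EventStructure} {f : E S → E T} (f-map : IsMap S T f) where
  private
    module S = EventStructure S
  open IsMap f-map

  reflects-≤-in-config : ∀ {x m n} → IsConfig S x → m ∈ x → n ∈ x →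
                         _≤_ T (f m) (f n) → _≤_ S m n
  reflects-≤-in-config {n = n} x-config@(_ , x-down) m∈x n∈x fm≤fn
    with ∈-map⁻ f (proj₂ (config-preserving (history-isConfig S x-config n∈x))
                         (∈-map⁺ f (S.history-≤ S.≤-refl)) fm≤fn)
  ... | q , q∈[n] , fm≡fq =
    subst (λ m' → _≤_ S m' n)
          (sym (locally-injective x-config m∈x (x-down n∈x (S.≤-history q∈[n])) fm≡fq))
          (S.≤-history q∈[n])

immediate-predecessor-unique : (A : Arena) → ∀ {a b c} →
  Immediate (es A) a c → Immediate (es A) b c → ¬ (a ≢ b)
immediate-predecessor-unique A (a<c , nothing-above-a) (b<c , nothing-above-b) a≢b
  with forestial A (proj₁ a<c) (proj₁ b<c)
... | inj₁ a≤b = nothing-above-a _ (a≤b , a≢b) b<c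
... | inj₂ b≤a = nothing-above-b _ (b≤a , λ b≡a → a≢b (sym b≡a)) a<c

lemmaA4 : (A : Arena) (S : CausalStrategy A) (m n : E (σ S)) →
          Compatible (σ S) m n → polσ S n ≡ minus →
          (Immediate (σ S) m n ⇔ Immediate (es A) (∂ S m) (∂ S n))
lemmaA4 A S m n (x , x-config@(_ , x-down) , m∈x , n∈x) n-negative =
  mk⇔ (λ m⋖n → courteous S m⋖n (inj₂ n-negative)) reflect
  where
  open EventStructure (σ S) using (_<_)
  open IsMap (∂-map S)

  reflect : Immediate (es A) (∂ S m) (∂ S n) → Immediate (σ S) m n
  reflect ∂m⋖∂n@((∂m≤∂n , ∂m≢∂n) , _) = (m≤n , m≢n) , nothing-between
    where
    m≤n : _≤_ (σ S) m n
    m≤n = reflects-≤-in-config (∂-map S) x-config m∈x n∈x ∂m≤∂n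

    m≢n : m ≢ n
    m≢n m≡n = ∂m≢∂n (cong (∂ S) m≡n)

    nothing-between : ∀ p → m < p → p < n → ⊥
    nothing-between p m<p p<n =
      ¬¬-immediate-above (σ S) p<n λ (s , p≤s , s⋖n@((s≤n , _) , _)) →
        immediate-predecessor-unique A (courteous S s⋖n (inj₂ n-negative)) ∂m⋖∂n
          λ ∂s≡∂m → let s≡m = locally-injective x-config (x-down n∈x s≤n) m∈x ∂s≡∂m in
                    <⇒≱ (σ S) m<p (subst (_≤_ (σ S) p) s≡m p≤s)
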